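{- Let $I$ be a $P$-interval of $\mathcal{P}$ with $|I|\geq 2$ and domain $D(I)=\{x_1,\ldots,x_r\}$. Then $I$ is a $b$-nested common interval if and only if there is some $i$, $1\le i\le r$, such that $\mathrm{Int}(x_i)$ is a $b$-nested common interval of size at least $|I|-b$.
   Context: Let $n,K\geq 1$ and let $\mathcal{P}=\{P_1,\ldots,P_K\}$ be a set of permutations of $\{1,\ldots,n\}$ with $P_1=\mathrm{Id}_n=(1,2,\ldots,n)$. For integers $i\le j$, $(i..j)$ denotes $\{i,\ldots,j\}$. A common interval of $\mathcal{P}$ is a set of integers occupying consecutive positions in every $P_k$; every common interval has the form $(i..j)$. Fix a positive integer $b$. A common interval $I$ is $b$-nested if $|I|=1$ or $I$ strictly contains a $b$-nested common interval $J$ with $|J|\geq |I|-b$. Two intervals $(i..j)$ and $(k..l)$ overlap if $i<k\le j<l$ or $k<i\le l<j$. A common interval is strong if it overlaps no other common interval. Let $T$ be the inclusion tree of the strong common intervals: nodes $x$ correspond bijectively to strong common intervals $\mathrm{Int}(x)$, the root to $(1..n)$, and $x$ is the parent of $y$ iff $\mathrm{Int}(x)$ is the smallest strong common interval strictly containing $\mathrm{Int}(y)$. A node $x$ with set of children $D$ is labeled $P$ if for every $D'\subset D$ with $2\le|D'|<|D|$ the union $\bigcup_{z\in D'}\mathrm{Int}(z)$ is not a common interval; otherwise it is labeled $Q$. For a strong common interval $I$, its domain $D(I)$ is the set of children of the node $x$ with $\mathrm{Int}(x)=I$. A $P$-interval is a strong common interval whose node is labeled $P$. -}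

module Defs where

open import Data.Nat using (ℕ; suc; _+_; _∸_) renaming (_≤_ to _≤ℕ_)
open import Data.Fin using (Fin; toℕ; _≤_; _<_)
open import Data.Fin.Permutation using (Permutation′; _⟨$⟩ʳ_)
open import Data.Product using (Σ; ∃; _×_; _,_; proj₁; proj₂)
open import Data.Sum using (_⊎_)
open import Data.Bool using (Bool; true)
open import Relation.Nullary using (¬_)
open import Relation.Binary.PropositionalEquality using (_≡_; _≢_)

-- Elements 1..n are represented by Fin n (value v is represented by v-1).
-- A permutation P is read as a sequence: P ⟨$⟩ʳ p is the element at position p.
-- An interval (i..j) is represented by its pair of endpoints.
Itv : ℕ → Set
Itv n = Fin n × Fin n

InItv : ∀ {n} → Itv n → Fin n → Set
InItv (i , j) x = i ≤ x × x ≤ j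

size : ∀ {n} → Itv n → ℕ
size (i , j) = suc (toℕ j ∸ toℕ i)

_⊆I_ : ∀ {n} → Itv n → Itv n → Set
(k , l) ⊆I (i , j) = i ≤ k × l ≤ j

_⊂I_ : ∀ {n} → Itv n → Itv n → Set
J ⊂I I = J ⊆I I × J ≢ I

Overlap : ∀ {n} → Itv n → Itv n → Set
Overlap (i , j) (k , l) = (i < k × k ≤ j × j < l) ⊎ (k < i × i ≤ l × l < j)

module _ {n K : ℕ} (Ps : Fin K → Permutation′ n) where

  Consecutive : Permutation′ n → (Fin n → Set) → Set
  Consecutive P S = Σ (Fin n) λ a → Σ (Fin n) λ c → a ≤ c ×
    (∀ p → (S (P ⟨$⟩ʳ p) → (a ≤ p × p ≤ c)) × ((a ≤ p × p ≤ c) → S (P ⟨$⟩ʳ p)))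

  IsCommonSet : (Fin n → Set) → Set
  IsCommonSet S = ∀ k → Consecutive (Ps k) S

  Common : Itv n → Set
  Common I = IsCommonSet (InItv I)

  data Nested (b : ℕ) : Itv n → Set where
    single : ∀ {I} → Common I → size I ≡ 1 → Nested b I
    step   : ∀ {I J} → Common I → Nested b J → J ⊂I I →
             size I ≤ℕ size J + b → Nested b I

  Strong : Itv n → Set
  Strong I = Common I × (∀ J → Common J → ¬ Overlap I J)

  -- y is a child of x in the inclusion tree T of strong common intervals:
  -- Int(x) is the smallest strong common interval strictly containing Int(y)
  Child : Itv n → Itv n → Set
  Child X Y = Strong X × Strong Y × Y ⊂I X × (∀ Z → Strong Z → Y ⊂I Z → X ⊆I Z)

  ⋃ : (Itv n → Bool) → Fin n → Set
  ⋃ D′ x = ∃ λ Z → D′ Z ≡ true × InItv Z x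

  -- node Int = X is labeled P: for every D′ ⊂ D(X) with 2 ≤ |D′| < |D(X)|,
  -- the union of the intervals in D′ is not a common interval
  PInterval : Itv n → Set
  PInterval X = Strong X ×
    (∀ (D′ : Itv n → Bool) → (∀ Z → D′ Z ≡ true → Child X Z) →
       (Σ (Itv n) λ Z₁ → Σ (Itv n) λ Z₂ → D′ Z₁ ≡ true × D′ Z₂ ≡ true × Z₁ ≢ Z₂) →
       (Σ (Itv n) λ Z → Child X Z × ¬ (D′ Z ≡ true)) →
       ¬ IsCommonSet (⋃ D′))

module Submission where

open import Defs
open import Data.Nat using (ℕ; suc; _+_; _∸_) renaming (_≤_ to _≤ℕ_; _<_ to _<ℕ_; _≤?_ to _≤ℕ?_)
import Data.Nat.Properties as ℕ
open import Data.Nat.Induction using (Acc; acc; <-wellFounded)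
open import Data.Fin using (Fin; zero; toℕ; _≤_)
import Data.Fin.Properties as Fin
open import Data.Fin.Permutation using (Permutation′; _⟨$⟩ʳ_; _⟨$⟩ˡ_; inverseʳ; inverseˡ)
open import Data.Product using (Σ; _×_; _,_; proj₁; proj₂)
open import Data.Product.Properties using (≡-dec)
open import Data.Sum using (_⊎_; inj₁; inj₂)
open import Data.Bool using (Bool; true)
open import Relation.Binary.Definitions using (DecidableEquality)
open import Relation.Nullary using (¬_; Dec; yes; no; does; contradiction)
open import Relation.Nullary.Decidable using (_×-dec_; _⊎-dec_; _→-dec_; ¬?; dec-true)
open import Relation.Unary using (Pred; Decidable; _≐_)
open import Relation.Binary.PropositionalEquality using (_≡_; _≢_; refl; sym; trans; cong; cong₂; subst)

-- Every element of a strong interval I with |I| ≥ 2 lies in a child of I: climb from the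
-- singleton through strong intervals strictly inside I until none is larger.  Now let I be
-- b-nested by a common J ⊂ I.  A child X meeting J does not overlap it, so J ⊆ X or X ⊆ J.
-- If no child contains J, then J is the union of the (at least two, and not all) children
-- it meets, contradicting the label P of I.  So J ⊆ X for a child X, which is then b-nested
-- and at least as large as J.

true⇒witness : ∀ {A : Set} (a? : Dec A) → does a? ≡ true → A
true⇒witness (yes a) _ = a
true⇒witness (no _) ()

module _ {n : ℕ} where

  ⊆I-refl : (A : Itv n) → A ⊆I A
  ⊆I-refl A = ℕ.≤-refl , ℕ.≤-refl

  ⊆I-antisym : {A B : Itv n} → A ⊆I B → B ⊆I A → A ≡ B
  ⊆I-antisym (i≤k , l≤j) (k≤i , j≤l) = cong₂ _,_ (Fin.≤-antisym k≤i i≤k) (Fin.≤-antisym l≤j j≤l)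

  ∈-⊆I : {A B : Itv n} {x : Fin n} → A ⊆I B → InItv A x → InItv B x
  ∈-⊆I (a , b) (c , d) = ℕ.≤-trans a c , ℕ.≤-trans d b

  ∈-singleton⁻ : {x y : Fin n} → InItv (x , x) y → y ≡ x
  ∈-singleton⁻ (x≤y , y≤x) = Fin.≤-antisym y≤x x≤y

  size-singleton : (x : Fin n) → size (x , x) ≡ 1
  size-singleton x = cong suc (ℕ.n∸n≡0 (toℕ x))

  size≤n : (A : Itv n) → size A ≤ℕ n
  size≤n (i , j) = ℕ.≤-trans (ℕ.+-monoʳ-≤ 1 (ℕ.m∸n≤m (toℕ j) (toℕ i))) (Fin.toℕ<n j)

  size-mono-⊆I : {A B : Itv n} → A ⊆I B → size A ≤ℕ size B
  size-mono-⊆I (i≤k , l≤j) = ℕ.+-monoʳ-≤ 1 (ℕ.∸-mono l≤j i≤k)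

  size-mono-⊂I : {A B : Itv n} → proj₁ A ≤ proj₂ A → A ⊂I B → size A <ℕ size B
  size-mono-⊂I {k , l} {i , j} k≤l ((i≤k , l≤j) , A≢B)
    with ℕ.m≤n⇒m<n∨m≡n i≤k | ℕ.m≤n⇒m<n∨m≡n l≤j
  ... | inj₁ i<k | _ =
    ℕ.+-monoʳ-< 1 (ℕ.≤-<-trans (ℕ.∸-monoˡ-≤ (toℕ k) l≤j) (ℕ.∸-monoʳ-< i<k (ℕ.≤-trans k≤l l≤j)))
  ... | inj₂ _ | inj₁ l<j =
    ℕ.+-monoʳ-< 1 (ℕ.<-≤-trans (ℕ.∸-monoˡ-< l<j k≤l) (ℕ.∸-monoʳ-≤ (toℕ j) i≤k))
  ... | inj₂ i≡k | inj₂ l≡j =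
    contradiction (cong₂ _,_ (sym (Fin.toℕ-injective i≡k)) (Fin.toℕ-injective l≡j)) A≢B

  ⊂I⇒∃-outside : {A B : Itv n} → proj₁ B ≤ proj₂ B → A ⊂I B →
    Σ (Fin n) λ y → InItv B y × ¬ InItv A y
  ⊂I⇒∃-outside {k , l} {i , j} i≤j (A⊆B , A≢B) with toℕ k ≤ℕ? toℕ i | toℕ j ≤ℕ? toℕ l
  ... | no k≰i | _      = i , (ℕ.≤-refl , i≤j) , λ i∈A → k≰i (proj₁ i∈A)
  ... | yes _  | no j≰l = j , (i≤j , ℕ.≤-refl) , λ j∈A → j≰l (proj₂ j∈A)
  ... | yes k≤i | yes j≤l = contradiction (⊆I-antisym A⊆B (k≤i , j≤l)) A≢B

  ¬Overlap⇒⊆I-comparable : {A B : Itv n} {x : Fin n} → InItv A x → InItv B x →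
    ¬ Overlap A B → A ⊆I B ⊎ B ⊆I A
  ¬Overlap⇒⊆I-comparable {i , j} {k , l} (i≤x , x≤j) (k≤x , x≤l) ¬ov
    with toℕ i ≤ℕ? toℕ k | toℕ l ≤ℕ? toℕ j
  ... | yes i≤k | yes l≤j = inj₂ (i≤k , l≤j)
  ... | no i≰k  | no l≰j  = inj₁ (ℕ.<⇒≤ (ℕ.≰⇒> i≰k) , ℕ.<⇒≤ (ℕ.≰⇒> l≰j))
  ... | yes i≤k | no l≰j with toℕ k ≤ℕ? toℕ i
  ...   | yes k≤i = inj₁ (k≤i , ℕ.<⇒≤ (ℕ.≰⇒> l≰j))
  ...   | no k≰i  = contradiction (inj₁ (ℕ.≰⇒> k≰i , ℕ.≤-trans k≤x x≤j , ℕ.≰⇒> l≰j)) ¬ov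
  ¬Overlap⇒⊆I-comparable {i , j} {k , l} (i≤x , x≤j) (k≤x , x≤l) ¬ov
    | no i≰k | yes l≤j with toℕ j ≤ℕ? toℕ l
  ...   | yes j≤l = inj₁ (ℕ.<⇒≤ (ℕ.≰⇒> i≰k) , j≤l)
  ...   | no j≰l  = contradiction (inj₂ (ℕ.≰⇒> i≰k , ℕ.≤-trans i≤x x≤l , ℕ.≰⇒> j≰l)) ¬ov

  _≟I_ : DecidableEquality (Itv n)
  _≟I_ = ≡-dec Fin._≟_ Fin._≟_

  InItv? : (A : Itv n) → Decidable (InItv A)
  InItv? (i , j) x = (i Fin.≤? x) ×-dec (x Fin.≤? j)

  _⊆I?_ : (A B : Itv n) → Dec (A ⊆I B)
  (k , l) ⊆I? (i , j) = (i Fin.≤? k) ×-dec (l Fin.≤? j)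

  _⊂I?_ : (A B : Itv n) → Dec (A ⊂I B)
  A ⊂I? B = (A ⊆I? B) ×-dec ¬? (A ≟I B)

  Overlap? : (A B : Itv n) → Dec (Overlap A B)
  Overlap? (i , j) (k , l) =
    (i Fin.<? k ×-dec k Fin.≤? j ×-dec j Fin.<? l) ⊎-dec (k Fin.<? i ×-dec i Fin.≤? l ×-dec l Fin.<? j)

  ∀-Itv? : {P : Itv n → Set} → Decidable P → Dec (∀ A → P A)
  ∀-Itv? P? with Fin.all? (λ i → Fin.all? λ j → P? (i , j))
  ... | yes ∀P = yes λ (i , j) → ∀P i j
  ... | no ¬∀P = no λ ∀P → ¬∀P λ i j → ∀P (i , j)

  ∃-Itv? : {P : Itv n → Set} → Decidable P → Dec (Σ (Itv n) P)
  ∃-Itv? P? with Fin.any? (λ i → Fin.any? λ j → P? (i , j))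
  ... | yes (i , j , p) = yes ((i , j) , p)
  ... | no ¬∃P = no λ ((i , j) , p) → ¬∃P (i , j , p)

module _ {n K : ℕ} (Ps : Fin K → Permutation′ n) where

  Consecutive-resp-≐ : (P : Permutation′ n) {S T : Pred (Fin n) _} → S ≐ T →
    Consecutive Ps P S → Consecutive Ps P T
  Consecutive-resp-≐ P (S⊆T , T⊆S) (a , c , a≤c , pos) =
    a , c , a≤c , λ p → (λ t → proj₁ (pos p) (T⊆S t)) , (λ r → S⊆T (proj₂ (pos p) r))

  Consecutive? : (P : Permutation′ n) {S : Pred (Fin n) _} → Decidable S → Dec (Consecutive Ps P S)
  Consecutive? P S? =
    Fin.any? λ a → Fin.any? λ c → a Fin.≤? c ×-dec Fin.all? λ p →
      (S? (P ⟨$⟩ʳ p) →-dec (a Fin.≤? p ×-dec p Fin.≤? c))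
      ×-dec ((a Fin.≤? p ×-dec p Fin.≤? c) →-dec S? (P ⟨$⟩ʳ p))

  Common? : (A : Itv n) → Dec (Common Ps A)
  Common? A = Fin.all? λ k → Consecutive? (Ps k) (InItv? A)

  Strong? : (A : Itv n) → Dec (Strong Ps A)
  Strong? A = Common? A ×-dec ∀-Itv? λ B → Common? B →-dec ¬? (Overlap? A B)

  Child? : (X Y : Itv n) → Dec (Child Ps X Y)
  Child? X Y = Strong? X ×-dec Strong? Y ×-dec (Y ⊂I? X) ×-dec
    ∀-Itv? λ Z → Strong? Z →-dec ((Y ⊂I? Z) →-dec (X ⊆I? Z))

  singleton-common : (x : Fin n) → Common Ps (x , x)
  singleton-common x k = P ⟨$⟩ˡ x , P ⟨$⟩ˡ x , ℕ.≤-refl , λ p →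
      (λ Pp∈x → at (trans (cong (P ⟨$⟩ˡ_) (sym (∈-singleton⁻ Pp∈x))) (inverseˡ P)))
    , (λ p∈x → subst (λ y → InItv (x , x) y)
                 (trans (sym (inverseʳ P)) (cong (P ⟨$⟩ʳ_) (sym (∈-singleton⁻ p∈x))))
                 (⊆I-refl (x , x)))
    where
    P = Ps k
    at : {p q : Fin n} → q ≡ p → InItv (q , q) p
    at refl = ⊆I-refl _

  singleton-strong : (x : Fin n) → Strong Ps (x , x)
  singleton-strong x = singleton-common x , λ where
    _ _ (inj₁ (x<k , k≤x , _)) → ℕ.<-irrefl refl (ℕ.<-≤-trans x<k k≤x)
    _ _ (inj₂ (_ , x≤l , l<x)) → ℕ.<-irrefl refl (ℕ.≤-<-trans x≤l l<x)

  Strong⇒⊆I-comparable : {X J : Itv n} {x : Fin n} → Strong Ps X → Common Ps J →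
    InItv X x → InItv J x → X ⊆I J ⊎ J ⊆I X
  Strong⇒⊆I-comparable {J = J} (_ , ¬ov) cJ x∈X x∈J = ¬Overlap⇒⊆I-comparable x∈X x∈J (¬ov J cJ)

  Nested⇒Common : {b : ℕ} {A : Itv n} → Nested Ps b A → Common Ps A
  Nested⇒Common (single cA _)   = cA
  Nested⇒Common (step cA _ _ _) = cA

  Nested-enlarge : {b : ℕ} {J X : Itv n} → Nested Ps b J → Common Ps X → J ⊆I X →
    size X ≤ℕ size J + b → Nested Ps b X
  Nested-enlarge {J = J} {X} nJ cX J⊆X bound with J ≟I X
  ... | yes refl = nJ
  ... | no J≢X  = step cX nJ (J⊆X , J≢X) bound

module _ {n K : ℕ} (Ps : Fin (suc K) → Permutation′ n) where

  -- Needs K+1 ≥ 1 permutations: for an empty family every set of elements is common.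
  Common⇒≤ : {i j : Fin n} → Common Ps (i , j) → i ≤ j
  Common⇒≤ c with c zero
  ... | a , _ , a≤c , pos = let i≤Pa , Pa≤j = proj₂ (pos a) (ℕ.≤-refl , a≤c) in ℕ.≤-trans i≤Pa Pa≤j

  module _ {I : Itv n} (sI : Strong Ps I) (2≤|I| : 2 ≤ℕ size I) where

    ∃-child-∋ : {y : Fin n} → InItv I y → Σ (Itv n) λ X → Child Ps I X × InItv X y
    ∃-child-∋ {y} y∈I =
      climb (y , y) (<-wellFounded _) (singleton-strong Ps y) (y∈I , singleton≢I) (⊆I-refl (y , y))
      where
      singleton≢I : (y , y) ≢ I
      singleton≢I refl = ℕ.<-irrefl refl (subst (2 ≤ℕ_) (size-singleton y) 2≤|I|)

      climb : (Y : Itv n) → Acc _<ℕ_ (n ∸ size Y) → Strong Ps Y → Y ⊂I I → InItv Y y →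
        Σ (Itv n) λ X → Child Ps I X × InItv X y
      climb Y (acc rs) sY Y⊂I y∈Y with ∃-Itv? (λ Z → Strong? Ps Z ×-dec (Y ⊂I? Z) ×-dec (Z ⊂I? I))
      ... | yes (Z , sZ , Y⊂Z , Z⊂I) =
        climb Z (rs (ℕ.∸-monoʳ-< (size-mono-⊂I (Common⇒≤ (proj₁ sY)) Y⊂Z) (size≤n Z)))
          sZ Z⊂I (∈-⊆I (proj₁ Y⊂Z) y∈Y)
      ... | no ∄Z = Y , (sI , sY , Y⊂I , minimal) , y∈Y
        where
        minimal : ∀ Z → Strong Ps Z → Y ⊂I Z → I ⊆I Z
        minimal Z sZ Y⊂Z with Strong⇒⊆I-comparable Ps sZ (proj₁ sI) (∈-⊆I (proj₁ Y⊂Z) y∈Y) y∈I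
        ... | inj₂ I⊆Z = I⊆Z
        ... | inj₁ Z⊆I with Z ≟I I
        ...   | yes refl = ⊆I-refl I
        ...   | no Z≢I  = contradiction (Z , sZ , Y⊂Z , Z⊆I , Z≢I) ∄Z

  PInterval⇒Common⊂-⊆-child : {I J : Itv n} → PInterval Ps I → 2 ≤ℕ size I →
    Common Ps J → J ⊂I I → Σ (Itv n) λ X → Child Ps I X × J ⊆I X
  PInterval⇒Common⊂-⊆-child {I} {J@(k , l)} (sI , labelP) 2≤|I| cJ J⊂I
    with ∃-Itv? (λ X → Child? Ps I X ×-dec (J ⊆I? X))
  ... | yes X = X
  ... | no ∄X = contradiction unionCommon (labelP D′ D′⇒child twoChildren missedChild)
    where
    k≤l : k ≤ l
    k≤l = Common⇒≤ cJ

    childOf : {y : Fin n} → InItv J y → Σ (Itv n) λ X → Child Ps I X × InItv X y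
    childOf y∈J = ∃-child-∋ sI 2≤|I| (∈-⊆I (proj₁ J⊂I) y∈J)

    child-meeting-J-⊆ : {X : Itv n} {y : Fin n} → Child Ps I X → InItv X y → InItv J y → X ⊆I J
    child-meeting-J-⊆ {X} chX@(_ , sX , _) y∈X y∈J with Strong⇒⊆I-comparable Ps sX cJ y∈X y∈J
    ... | inj₁ X⊆J = X⊆J
    ... | inj₂ J⊆X = contradiction (X , chX , J⊆X) ∄X

    D′? : (Z : Itv n) → Dec (Child Ps I Z × Z ⊆I J)
    D′? Z = Child? Ps I Z ×-dec (Z ⊆I? J)

    D′ : Itv n → Bool
    D′ Z = does (D′? Z)

    D′-∋ : {X : Itv n} {y : Fin n} → Child Ps I X → InItv X y → InItv J y → D′ X ≡ true
    D′-∋ chX y∈X y∈J = dec-true (D′? _) (chX , child-meeting-J-⊆ chX y∈X y∈J)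

    D′⇒child : ∀ Z → D′ Z ≡ true → Child Ps I Z
    D′⇒child Z t = proj₁ (true⇒witness (D′? Z) t)

    twoChildren : Σ (Itv n) λ Z₁ → Σ (Itv n) λ Z₂ → D′ Z₁ ≡ true × D′ Z₂ ≡ true × Z₁ ≢ Z₂
    twoChildren = distinct (childOf (ℕ.≤-refl , k≤l)) (childOf (k≤l , ℕ.≤-refl))
      where
      distinct : (Σ (Itv n) λ X → Child Ps I X × InItv X k) → (Σ (Itv n) λ X → Child Ps I X × InItv X l) →
        Σ (Itv n) λ Z₁ → Σ (Itv n) λ Z₂ → D′ Z₁ ≡ true × D′ Z₂ ≡ true × Z₁ ≢ Z₂
      distinct (Xk , chk , k∈Xk) (Xl , chl , l∈Xl) =
        Xk , Xl , D′-∋ chk k∈Xk (ℕ.≤-refl , k≤l) , D′-∋ chl l∈Xl (k≤l , ℕ.≤-refl) , Xk≢Xl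
        where
        Xk≢Xl : Xk ≢ Xl
        Xk≢Xl Xk≡Xl = contradiction
          (Xk , chk , proj₁ k∈Xk , proj₂ (subst (λ X → InItv X l) (sym Xk≡Xl) l∈Xl)) ∄X

    missedChild : Σ (Itv n) λ Z → Child Ps I Z × ¬ (D′ Z ≡ true)
    missedChild =
      let y , y∈I , y∉J = ⊂I⇒∃-outside (Common⇒≤ (proj₁ sI)) J⊂I
          X , chX , y∈X = ∃-child-∋ sI 2≤|I| y∈I
      in X , chX , λ t → y∉J (∈-⊆I (proj₂ (true⇒witness (D′? X) t)) y∈X)

    J≐⋃D′ : InItv J ≐ ⋃ Ps D′
    J≐⋃D′ = to , from
      where
      to : ∀ {y} → InItv J y → ⋃ Ps D′ y
      to y∈J = let X , chX , y∈X = childOf y∈J in X , D′-∋ chX y∈X y∈J , y∈X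
      from : ∀ {y} → ⋃ Ps D′ y → InItv J y
      from (Z , t , y∈Z) = ∈-⊆I (proj₂ (true⇒witness (D′? Z) t)) y∈Z

    unionCommon : IsCommonSet Ps (⋃ Ps D′)
    unionCommon q = Consecutive-resp-≐ Ps (Ps q) J≐⋃D′ (cJ q)

lemma2 : (n K b : ℕ) → 1 ≤ℕ b →
    (Ps : Fin (suc K) → Permutation′ n) → (∀ p → Ps zero ⟨$⟩ʳ p ≡ p) →
    (I : Itv n) → PInterval Ps I → 2 ≤ℕ size I →
    (Nested Ps b I →
       Σ (Itv n) λ X → Child Ps I X × Nested Ps b X × size I ≤ℕ size X + b)
    × ((Σ (Itv n) λ X → Child Ps I X × Nested Ps b X × size I ≤ℕ size X + b) →
       Nested Ps b I)
lemma2 n K b _ Ps _ I pI 2≤|I| = nested⇒child , child⇒nested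
  where
  nested⇒child : Nested Ps b I →
    Σ (Itv n) λ X → Child Ps I X × Nested Ps b X × size I ≤ℕ size X + b
  nested⇒child (single _ |I|≡1) = contradiction (subst (2 ≤ℕ_) |I|≡1 2≤|I|) (ℕ.<-irrefl refl)
  nested⇒child (step _ nJ J⊂I |I|≤|J|+b)
    with PInterval⇒Common⊂-⊆-child Ps pI 2≤|I| (Nested⇒Common Ps nJ) J⊂I
  ... | X , chX@(_ , sX , (X⊆I , _) , _) , J⊆X =
    X , chX , Nested-enlarge Ps nJ (proj₁ sX) J⊆X (ℕ.≤-trans (size-mono-⊆I X⊆I) |I|≤|J|+b)
      , ℕ.≤-trans |I|≤|J|+b (ℕ.+-monoˡ-≤ b (size-mono-⊆I J⊆X))

  child⇒nested : (Σ (Itv n) λ X → Child Ps I X × Nested Ps b X × size I ≤ℕ size X + b) →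
    Nested Ps b I
  child⇒nested (_ , ((cI , _) , _ , X⊂I , _) , nX , bound) = step cI nX X⊂I bound
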